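{- Let $\mathfrak K=(K,\bigsqcup,\odot,{}^*,{\sim},e)$ be an involutive generalized dynamic algebra. Then the action $\bullet:K\times\widetilde K\to\widetilde K$, $k\bullet v={\sim}{\sim}(k\odot v)$, makes $(\widetilde K,\bigvee,\bullet)$ a left unital $K$-module (in particular $(\widetilde K,\preceq)$ is a complete lattice in which $\bigvee W$ is the join of $W\subseteq\widetilde K$), with least element ${\sim}{\sim}0$ and greatest element ${\sim}{\sim}1$, and moreover ${\sim}{\sim}{\sim}v={\sim}v$ for every $v\in K$.
   Context: A unital involutive quantale is $(K,\bigsqcup,\odot,{}^*,e)$ where $(K,\bigsqcup)$ is a complete join-semilattice (hence a complete lattice, binary join $\sqcup$, least element $0=\bigsqcup\emptyset$, greatest element $1=\bigsqcup K$), $\odot$ is associative and distributes over arbitrary joins in each argument, $e$ is a two-sided unit, and ${}^*$ satisfies $x^{**}=x$, $(x\odot y)^*=y^*\odot x^*$, $(\bigsqcup_i x_i)^*=\bigsqcup_i x_i^*$. An involutive generalized dynamic algebra is $(K,\bigsqcup,\odot,{}^*,{\sim},e)$ where $(K,\bigsqcup,\odot,{}^*,e)$ is a unital involutive quantale and ${\sim}:K\to K$ satisfies, for all $x,y\in K$ and all (possibly empty) families $(x_i)_{i\in I}$: (i) ${\sim}(x\odot{\sim}{\sim}y)={\sim}(x\odot y)$; (ii) ${\sim}(\bigsqcup_i{\sim}{\sim}x_i)={\sim}(\bigsqcup_i x_i)$; (iii) $({\sim}x)^*={\sim}x$; (iv) ${\sim}{\sim}({\sim}{\sim}x\odot y)={\sim}({\sim}x\sqcup{\sim}({\sim}x\sqcup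 y))$. Notation: $\widetilde K=\{{\sim}k:k\in K\}$; for $W\subseteq\widetilde K$, $\bigvee W:={\sim}{\sim}(\bigsqcup W)$; for $k,l\in\widetilde K$, $k\preceq l$ iff $\bigvee\{k,l\}=l$. A left unital $K$-module is a complete join-semilattice $(A,\bigvee)$ with a map $\bullet:K\times A\to A$ such that $v\bullet\bigvee S=\bigvee_{s\in S}v\bullet s$, $(\bigsqcup T)\bullet a=\bigvee_{t\in T}t\bullet a$, $u\bullet(v\bullet a)=(u\odot v)\bullet a$ and $e\bullet a=a$ for all $S\subseteq A$, $T\subseteq K$, $u,v\in K$, $a\in A$. -}

module Defs where

open import Level using (Level; suc; _⊔_)
open import Data.Product using (Σ; ∃; _×_; _,_)
open import Data.Sum using (_⊎_)
open import Data.Unit.Polymorphic using (⊤)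
open import Data.Empty.Polymorphic using (⊥)
open import Relation.Binary.PropositionalEquality using (_≡_)

Subset : ∀ {ℓ} → Set ℓ → Set (suc ℓ)
Subset {ℓ} X = X → Set ℓ

module _ {ℓ : Level} {X : Set ℓ} where

  _⊆_ : Subset X → Subset X → Set ℓ
  S ⊆ A = ∀ x → S x → A x

  pair : X → X → Subset X
  pair x y z = (z ≡ x) ⊎ (z ≡ y)

  image : {I : Set ℓ} → (I → X) → Subset I → Subset X
  image f S z = ∃ λ s → S s × (z ≡ f s)

  range : {I : Set ℓ} → (I → X) → Subset X
  range {I} f z = ∃ λ (i : I) → z ≡ f i

  module JoinOrder (⋁ : Subset X → X) where
    _≼_ : X → X → Set ℓ
    x ≼ y = ⋁ (pair x y) ≡ y

  record IsCompleteJoinSemilatticeOn (A : Subset X) (⋁ : Subset X → X) : Set (suc ℓ) where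
    open JoinOrder ⋁ public
    field
      ⋁-closed  : ∀ S → S ⊆ A → A (⋁ S)
      ≼-refl    : ∀ x → A x → x ≼ x
      ≼-antisym : ∀ x y → A x → A y → x ≼ y → y ≼ x → x ≡ y
      ≼-trans   : ∀ x y z → A x → A y → A z → x ≼ y → y ≼ z → x ≼ z
      ⋁-upper   : ∀ S → S ⊆ A → ∀ s → S s → s ≼ ⋁ S
      ⋁-least   : ∀ S → S ⊆ A → ∀ u → A u → (∀ s → S s → s ≼ u) → ⋁ S ≼ u

record UnitalInvolutiveQuantale (ℓ : Level) : Set (suc ℓ) where
  infixl 7 _⊙_
  field
    K   : Set ℓ
    ⨆   : Subset K → K
    _⊙_ : K → K → K
    _*  : K → K
    e   : K
    ⨆-cjsl    : IsCompleteJoinSemilatticeOn (λ (_ : K) → ⊤) ⨆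
    ⊙-assoc   : ∀ x y z → (x ⊙ y) ⊙ z ≡ x ⊙ (y ⊙ z)
    ⊙-distribˡ : ∀ x S → x ⊙ ⨆ S ≡ ⨆ (image (λ s → x ⊙ s) S)
    ⊙-distribʳ : ∀ x S → ⨆ S ⊙ x ≡ ⨆ (image (λ s → s ⊙ x) S)
    e-identityˡ : ∀ x → e ⊙ x ≡ x
    e-identityʳ : ∀ x → x ⊙ e ≡ x
    *-involutive : ∀ x → (x *) * ≡ x
    *-⊙ : ∀ x y → (x ⊙ y) * ≡ (y *) ⊙ (x *)
    *-⨆ : ∀ S → (⨆ S) * ≡ ⨆ (image _* S)

  _⊔ₖ_ : K → K → K
  x ⊔ₖ y = ⨆ (pair x y)

  0ₖ : K
  0ₖ = ⨆ (λ _ → ⊥)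

  1ₖ : K
  1ₖ = ⨆ (λ _ → ⊤)

record IsLeftUnitalModuleOn {ℓ : Level} (Q : UnitalInvolutiveQuantale ℓ)
         {X : Set ℓ} (A : Subset X) (⋁ : Subset X → X)
         (_•_ : UnitalInvolutiveQuantale.K Q → X → X) : Set (suc ℓ) where
  open UnitalInvolutiveQuantale Q
  field
    cjsl     : IsCompleteJoinSemilatticeOn A ⋁
    •-closed : ∀ v a → A a → A (v • a)
    •-⋁      : ∀ v S → S ⊆ A → v • ⋁ S ≡ ⋁ (image (λ s → v • s) S)
    ⨆-•      : ∀ T a → A a → (⨆ T) • a ≡ ⋁ (image (λ t → t • a) T)
    •-assoc  : ∀ u v a → A a → u • (v • a) ≡ (u ⊙ v) • a
    •-unit   : ∀ a → A a → e • a ≡ a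

record IGDA (ℓ : Level) : Set (suc ℓ) where
  field
    quantale : UnitalInvolutiveQuantale ℓ
  open UnitalInvolutiveQuantale quantale public
  field
    ~_ : K → K
    ~-i   : ∀ x y → ~ (x ⊙ ~ ~ y) ≡ ~ (x ⊙ y)
    ~-ii  : ∀ (I : Set ℓ) (x : I → K) →
              ~ (⨆ (range (λ i → ~ ~ x i))) ≡ ~ (⨆ (range x))
    ~-iii : ∀ x → (~ x) * ≡ ~ x
    ~-iv  : ∀ x y → ~ ~ (~ ~ x ⊙ y) ≡ ~ ((~ x) ⊔ₖ (~ ((~ x) ⊔ₖ y)))

  K̃ : Subset K
  K̃ x = ∃ λ k → x ≡ ~ k

  ⋁ : Subset K → K
  ⋁ W = ~ ~ (⨆ W)

  _⪯_ : K → K → Set ℓ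
  k ⪯ l = ⋁ (pair k l) ≡ l

  _•_ : K → K → K
  k • v = ~ ~ (k ⊙ v)

-- Only axioms (i) and (ii) are needed.  By (ii), ~ (⨆ S) depends only on the
-- set of double negations { ~~s : s ∈ S }; taking S = {x} gives ~~~x = ~x, so
-- ~~ is idempotent and K̃ is exactly its set of fixed points.  Hence ⋁ W = ~~(⨆ W)
-- is the join of K̃ for the order "~~(x ⊔ y) = y", transferred from K along ~~.
-- Axiom (i) lets ~~ be absorbed into the right factor of ⊙, which gives the
-- associativity of the action, and the distributivity of ⊙ over ⨆ in K yields
-- the two distributive laws of the module.
module Submission where

open import Defs
open import Data.Product using (_×_; _,_; Σ; ∃; proj₁)
open import Data.Sum using (_⊎_; inj₁; inj₂)
open import Data.Unit.Polymorphic using (⊤; tt)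
open import Relation.Binary.PropositionalEquality using (_≡_; refl; sym; trans; cong)
open Relation.Binary.PropositionalEquality.≡-Reasoning

module CompleteJoinSemilattice {ℓ} {X : Set ℓ} {⨆ : Subset X → X}
         (isCJSL : IsCompleteJoinSemilatticeOn (λ (_ : X) → ⊤) ⨆) where

  open IsCompleteJoinSemilatticeOn isCJSL using (_≼_; ≼-refl)
  private module L = IsCompleteJoinSemilatticeOn isCJSL

  infixl 6 _⊔_
  _⊔_ : X → X → X
  x ⊔ y = ⨆ (pair x y)

  ⨆-upper : ∀ S s → S s → s ≼ ⨆ S
  ⨆-upper S s = L.⋁-upper S (λ _ _ → tt) s

  ⨆-least : ∀ S u → (∀ s → S s → s ≼ u) → ⨆ S ≼ u
  ⨆-least S u = L.⋁-least S (λ _ _ → tt) u tt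

  ≼-antisym : ∀ x y → x ≼ y → y ≼ x → x ≡ y
  ≼-antisym x y = L.≼-antisym x y tt tt

  ≼-trans : ∀ x y z → x ≼ y → y ≼ z → x ≼ z
  ≼-trans x y z = L.≼-trans x y z tt tt tt

  ⨆-mono : ∀ S T → S ⊆ T → ⨆ S ≼ ⨆ T
  ⨆-mono S T S⊆T = ⨆-least S (⨆ T) (λ s Ss → ⨆-upper T s (S⊆T s Ss))

  ⨆-ext : ∀ S T → S ⊆ T → T ⊆ S → ⨆ S ≡ ⨆ T
  ⨆-ext S T S⊆T T⊆S = ≼-antisym _ _ (⨆-mono S T S⊆T) (⨆-mono T S T⊆S)

  ⊔-idem : ∀ x → x ⊔ x ≡ x
  ⊔-idem x = ≼-refl x tt

  x≼x⊔y : ∀ x y → x ≼ (x ⊔ y)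
  x≼x⊔y x y = ⨆-upper (pair x y) x (inj₁ refl)

  y≼x⊔y : ∀ x y → y ≼ (x ⊔ y)
  y≼x⊔y x y = ⨆-upper (pair x y) y (inj₂ refl)

  ⊔-least : ∀ x y u → x ≼ u → y ≼ u → (x ⊔ y) ≼ u
  ⊔-least x y u x≼u y≼u = ⨆-least (pair x y) u λ { _ (inj₁ refl) → x≼u ; _ (inj₂ refl) → y≼u }

  ⊔-comm : ∀ x y → x ⊔ y ≡ y ⊔ x
  ⊔-comm x y = ⨆-ext _ _ (λ { _ (inj₁ refl) → inj₂ refl ; _ (inj₂ refl) → inj₁ refl })
                         (λ { _ (inj₁ refl) → inj₂ refl ; _ (inj₂ refl) → inj₁ refl })

  ⊔-assoc : ∀ x y z → x ⊔ (y ⊔ z) ≡ (x ⊔ y) ⊔ z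
  ⊔-assoc x y z = ≼-antisym _ _
    (⊔-least _ _ _ (≼-trans _ _ _ (x≼x⊔y x y) (x≼x⊔y _ z))
      (⊔-least _ _ _ (≼-trans _ _ _ (y≼x⊔y x y) (x≼x⊔y _ z)) (y≼x⊔y _ z)))
    (⊔-least _ _ _ (⊔-least _ _ _ (x≼x⊔y x _) (≼-trans _ _ _ (x≼x⊔y y z) (y≼x⊔y x _)))
      (≼-trans _ _ _ (y≼x⊔y y z) (y≼x⊔y x _)))

  -- u is added to the right-hand set so that the identity also holds for S = ∅.
  ⨆-⊔ʳ : ∀ S u → ⨆ S ⊔ u ≡ ⨆ (λ z → image (_⊔ u) S z ⊎ z ≡ u)
  ⨆-⊔ʳ S u = ≼-antisym _ _
    (⊔-least _ _ _
      (⨆-least S _ λ s Ss → ≼-trans _ _ _ (x≼x⊔y s u) (⨆-upper A _ (inj₁ (s , Ss , refl))))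
      (⨆-upper A u (inj₂ refl)))
    (⨆-least A _ λ
      { _ (inj₁ (s , Ss , refl)) →
          ⊔-least _ _ _ (≼-trans _ _ _ (⨆-upper S s Ss) (x≼x⊔y _ u)) (y≼x⊔y _ u)
      ; _ (inj₂ refl) → y≼x⊔y _ u })
    where
      A : Subset X
      A z = image (_⊔ u) S z ⊎ z ≡ u

module DynamicAlgebra {ℓ} (𝔎 : IGDA ℓ) where

  open IGDA 𝔎
  open CompleteJoinSemilattice ⨆-cjsl

  ~-⨆-~~ : ∀ S → ~ (⨆ S) ≡ ~ (⨆ (image (λ s → ~ ~ s) S))
  ~-⨆-~~ S = begin
      ~ (⨆ S)
    ≡⟨ cong ~_ (⨆-ext S (range {I = Σ K S} proj₁)
         (λ z Sz → (z , Sz) , refl) (λ { _ ((_ , Ss) , refl) → Ss })) ⟩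
      ~ (⨆ (range {I = Σ K S} proj₁))
    ≡⟨ sym (~-ii (Σ K S) proj₁) ⟩
      ~ (⨆ (range {I = Σ K S} (λ i → ~ ~ proj₁ i)))
    ≡⟨ cong ~_ (⨆-ext _ _ (λ { _ ((s , Ss) , refl) → s , Ss , refl })
                          (λ { _ (s , Ss , refl) → (s , Ss) , refl })) ⟩
      ~ (⨆ (image (λ s → ~ ~ s) S))
    ∎

  ~-⨆-cong : ∀ S T → (∀ s → S s → ∃ λ t → T t × (~ ~ s ≡ ~ ~ t))
                   → (∀ t → T t → ∃ λ s → S s × (~ ~ t ≡ ~ ~ s))
                   → ~ (⨆ S) ≡ ~ (⨆ T)
  ~-⨆-cong S T S→T T→S = begin
      ~ (⨆ S)
    ≡⟨ ~-⨆-~~ S ⟩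
      ~ (⨆ (image (λ s → ~ ~ s) S))
    ≡⟨ cong ~_ (⨆-ext _ _
         (λ { _ (s , Ss , refl) → let (t , Tt , eq) = S→T s Ss in t , Tt , eq })
         (λ { _ (t , Tt , refl) → let (s , Ss , eq) = T→S t Tt in s , Ss , eq })) ⟩
      ~ (⨆ (image (λ t → ~ ~ t) T))
    ≡⟨ sym (~-⨆-~~ T) ⟩
      ~ (⨆ T)
    ∎

  ~~~≡~ : ∀ x → ~ ~ ~ x ≡ ~ x
  ~~~≡~ x = sym (begin
      ~ x
    ≡⟨ cong ~_ (sym (⊔-idem x)) ⟩
      ~ (x ⊔ x)
    ≡⟨ ~-⨆-~~ (pair x x) ⟩
      ~ (⨆ (image (λ s → ~ ~ s) (pair x x)))
    ≡⟨ cong ~_ (⨆-ext _ (pair (~ ~ x) (~ ~ x))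
         (λ { _ (_ , inj₁ refl , refl) → inj₁ refl ; _ (_ , inj₂ refl , refl) → inj₁ refl })
         (λ { _ (inj₁ refl) → x , inj₁ refl , refl ; _ (inj₂ refl) → x , inj₁ refl , refl })) ⟩
      ~ (~ ~ x ⊔ ~ ~ x)
    ≡⟨ cong ~_ (⊔-idem (~ ~ x)) ⟩
      ~ ~ ~ x
    ∎)

  ~~~~≡~~ : ∀ x → ~ ~ ~ ~ x ≡ ~ ~ x
  ~~~~≡~~ x = cong ~_ (~~~≡~ x)

  ~~-fixes-K̃ : ∀ a → K̃ a → ~ ~ a ≡ a
  ~~-fixes-K̃ _ (k , refl) = ~~~≡~ k

  ~-⊔-~~ˡ : ∀ x y → ~ (~ ~ x ⊔ y) ≡ ~ (x ⊔ y)
  ~-⊔-~~ˡ x y = ~-⨆-cong _ _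
    (λ { _ (inj₁ refl) → x , inj₁ refl , ~~~~≡~~ x ; _ (inj₂ refl) → y , inj₂ refl , refl })
    (λ { _ (inj₁ refl) → ~ ~ x , inj₁ refl , sym (~~~~≡~~ x) ; _ (inj₂ refl) → y , inj₂ refl , refl })

  ~-⊔-~~ʳ : ∀ x y → ~ (x ⊔ ~ ~ y) ≡ ~ (x ⊔ y)
  ~-⊔-~~ʳ x y = trans (cong ~_ (⊔-comm x _)) (trans (~-⊔-~~ˡ y x) (cong ~_ (⊔-comm y x)))

  ~~-⨆-image : ∀ {I : Set ℓ} (f : I → K) (S : Subset I) →
    ~ ~ (⨆ (image f S)) ≡ ~ ~ (⨆ (image (λ s → ~ ~ f s) S))
  ~~-⨆-image f S = cong ~_ (~-⨆-cong _ _
    (λ { _ (s , Ss , refl) → ~ ~ f s , (s , Ss , refl) , sym (~~~~≡~~ (f s)) })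
    (λ { _ (s , Ss , refl) → f s , (s , Ss , refl) , ~~~~≡~~ (f s) }))

  ⪯-trans : ∀ x y z → x ⪯ y → y ⪯ z → x ⪯ z
  ⪯-trans x y z x⪯y y⪯z = trans (cong ~_ (begin
      ~ (x ⊔ z)
    ≡⟨ cong (λ w → ~ (x ⊔ w)) (sym y⪯z) ⟩
      ~ (x ⊔ ~ ~ (y ⊔ z))
    ≡⟨ ~-⊔-~~ʳ x (y ⊔ z) ⟩
      ~ (x ⊔ (y ⊔ z))
    ≡⟨ cong ~_ (⊔-assoc x y z) ⟩
      ~ ((x ⊔ y) ⊔ z)
    ≡⟨ sym (~-⊔-~~ˡ (x ⊔ y) z) ⟩
      ~ (~ ~ (x ⊔ y) ⊔ z)
    ≡⟨ cong (λ w → ~ (w ⊔ z)) x⪯y ⟩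
      ~ (y ⊔ z)
    ∎)) y⪯z

  ⋁-least : ∀ S u → K̃ u → (∀ s → S s → s ⪯ u) → ⋁ S ⪯ u
  ⋁-least S u u∈K̃ s⪯u = trans (cong ~_ (begin
      ~ (~ ~ (⨆ S) ⊔ u)
    ≡⟨ ~-⊔-~~ˡ (⨆ S) u ⟩
      ~ (⨆ S ⊔ u)
    ≡⟨ cong ~_ (⨆-⊔ʳ S u) ⟩
      ~ (⨆ (λ z → image (_⊔ u) S z ⊎ z ≡ u))
    ≡⟨ ~-⨆-cong _ (pair u u)
         (λ { _ (inj₁ (s , Ss , refl)) → u , inj₁ refl , trans (s⪯u s Ss) (sym (~~-fixes-K̃ u u∈K̃))
            ; _ (inj₂ refl) → u , inj₁ refl , refl })
         (λ { _ (inj₁ refl) → u , inj₂ refl , refl ; _ (inj₂ refl) → u , inj₂ refl , refl }) ⟩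
      ~ (u ⊔ u)
    ≡⟨ cong ~_ (⊔-idem u) ⟩
      ~ u
    ∎)) (~~-fixes-K̃ u u∈K̃)

  K̃-isCompleteJoinSemilattice : IsCompleteJoinSemilatticeOn K̃ ⋁
  K̃-isCompleteJoinSemilattice = record
    { ⋁-closed  = λ S _ → ~ (⨆ S) , refl
    ; ≼-refl    = λ x x∈K̃ → trans (cong (λ w → ~ ~ w) (⊔-idem x)) (~~-fixes-K̃ x x∈K̃)
    ; ≼-antisym = λ x y _ _ x⪯y y⪯x →
        trans (sym y⪯x) (trans (cong (λ w → ~ ~ w) (⊔-comm y x)) x⪯y)
    ; ≼-trans   = λ x y z _ _ _ → ⪯-trans x y z
    ; ⋁-upper   = λ S _ s Ss → cong ~_ (trans (~-⊔-~~ʳ s (⨆ S)) (cong ~_ (⨆-upper S s Ss)))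
    ; ⋁-least   = λ S _ → ⋁-least S
    }

  K̃-isLeftUnitalModule : IsLeftUnitalModuleOn quantale K̃ ⋁ _•_
  K̃-isLeftUnitalModule = record
    { cjsl     = K̃-isCompleteJoinSemilattice
    ; •-closed = λ v a _ → ~ (v ⊙ a) , refl
    ; •-⋁      = λ v S _ → begin
        ~ ~ (v ⊙ ~ ~ (⨆ S))                   ≡⟨ cong ~_ (~-i v (⨆ S)) ⟩
        ~ ~ (v ⊙ ⨆ S)                         ≡⟨ cong (λ w → ~ ~ w) (⊙-distribˡ v S) ⟩
        ~ ~ (⨆ (image (v ⊙_) S))              ≡⟨ ~~-⨆-image (v ⊙_) S ⟩
        ⋁ (image (v •_) S)                    ∎
    ; ⨆-•      = λ T a _ → trans (cong (λ w → ~ ~ w) (⊙-distribʳ a T)) (~~-⨆-image (_⊙ a) T)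
    ; •-assoc  = λ u v a _ → trans (cong ~_ (~-i u (v ⊙ a))) (cong (λ w → ~ ~ w) (sym (⊙-assoc u v a)))
    ; •-unit   = λ a a∈K̃ → trans (cong (λ w → ~ ~ w) (e-identityˡ a)) (~~-fixes-K̃ a a∈K̃)
    }

  ~~0-least : ∀ v → K̃ v → (~ ~ 0ₖ) ⪯ v
  ~~0-least v v∈K̃ = trans (cong ~_ (trans (~-⊔-~~ˡ 0ₖ v)
      (cong ~_ (⨆-least _ v (λ _ ()))))) (~~-fixes-K̃ v v∈K̃)

  ~~1-greatest : ∀ v → K̃ v → v ⪯ (~ ~ 1ₖ)
  ~~1-greatest v _ = cong ~_ (trans (~-⊔-~~ʳ v 1ₖ) (cong ~_ (⨆-upper _ v tt)))

theorem3p3 : ∀ {ℓ} (𝔎 : IGDA ℓ) →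
    IsLeftUnitalModuleOn (IGDA.quantale 𝔎) (IGDA.K̃ 𝔎) (IGDA.⋁ 𝔎) (IGDA._•_ 𝔎)
    × (IGDA.K̃ 𝔎 (IGDA.~_ 𝔎 (IGDA.~_ 𝔎 (IGDA.0ₖ 𝔎)))
       × (∀ v → IGDA.K̃ 𝔎 v → IGDA._⪯_ 𝔎 (IGDA.~_ 𝔎 (IGDA.~_ 𝔎 (IGDA.0ₖ 𝔎))) v))
    × (IGDA.K̃ 𝔎 (IGDA.~_ 𝔎 (IGDA.~_ 𝔎 (IGDA.1ₖ 𝔎)))
       × (∀ v → IGDA.K̃ 𝔎 v → IGDA._⪯_ 𝔎 v (IGDA.~_ 𝔎 (IGDA.~_ 𝔎 (IGDA.1ₖ 𝔎)))))
    × (∀ v → IGDA.~_ 𝔎 (IGDA.~_ 𝔎 (IGDA.~_ 𝔎 v)) ≡ IGDA.~_ 𝔎 v)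
theorem3p3 𝔎 =
    K̃-isLeftUnitalModule
  , ((~ 0ₖ , refl) , ~~0-least)
  , ((~ 1ₖ , refl) , ~~1-greatest)
  , ~~~≡~
  where
    open IGDA 𝔎
    open DynamicAlgebra 𝔎
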